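{- For $n\geq 3$, $$\left|\mathcal{A}_n(1324,1423;213)\big|_2^n\right|=n-2.$$
   Context: A permutation $\pi$ of $[n]=\{1,\dots,n\}$ is cyclic if it consists of a single $n$-cycle. Its one-line notation is $\pi_1\pi_2\cdots\pi_n$ with $\pi_i=\pi(i)$. Its standard cycle form is $(c_1,c_2,\dots,c_n)$ with $c_1=1$ and $c_{i+1}=\pi(c_i)$ for $1\le i<n$. A sequence $w_1\cdots w_n$ of distinct integers contains a pattern $\sigma=\sigma_1\cdots\sigma_k\in S_k$ if there are indices $i_1<\dots<i_k$ with $w_{i_s}>w_{i_t}$ iff $\sigma_s>\sigma_t$ for all $s<t$; otherwise it avoids $\sigma$. $\mathcal{A}_n(1324,1423;213)$ is the set of cyclic permutations of $[n]$ whose one-line notation avoids $1324$ and $1423$ and whose standard cycle form $c_1\cdots c_n$, read as a sequence, avoids $213$. $\mathcal{A}_n(1324,1423;213)\big|_2^n$ is the set of its elements whose standard cycle form has $c_n=2$. -}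

module Defs where

open import Data.Nat using (ℕ; zero; suc; _<_; _>_)
open import Data.Fin using (Fin; toℕ)
import Data.Fin as F
open import Data.Vec using (Vec; lookup; toList)
open import Data.List using (List; []; _∷_; length; map; last)
open import Data.Maybe using (just)
open import Data.Product using (_×_; ∃-syntax)
open import Relation.Binary.PropositionalEquality using (_≡_)
open import Function.Bundles using (_⇔_)
open import Data.List.Relation.Binary.Sublist.Propositional using (_⊆_)
open import Data.List.Relation.Unary.Unique.Propositional using (Unique)

-- A permutation of [n] in one-line notation: the vector (π(1),…,π(n)),
-- with the values 1..n encoded 0-based as Fin n.
IsPerm : {n : ℕ} → Vec (Fin n) n → Set
IsPerm {n} v = ∀ (i j : Fin n) → lookup v i ≡ lookup v j → i ≡ j

orbit : {n : ℕ} → Vec (Fin n) n → Fin n → ℕ → List (Fin n)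
orbit v c zero    = []
orbit v c (suc k) = c ∷ orbit v (lookup v c) k

-- Standard cycle form (c₁,…,cₙ): c₁ = 1 (i.e. F.zero), c_{i+1} = π(c_i).
cycleForm : {n : ℕ} → Vec (Fin n) n → List (Fin n)
cycleForm {zero}  v = []
cycleForm {suc n} v = orbit v F.zero (suc n)

IsCyclic : {n : ℕ} → Vec (Fin n) n → Set
IsCyclic v = IsPerm v × Unique (cycleForm v)

-- entry of a list at position i (default 0 out of range)
at : List ℕ → ℕ → ℕ
at []       _       = 0
at (x ∷ xs) zero    = x
at (x ∷ xs) (suc i) = at xs i

OrderIso : List ℕ → List ℕ → Set
OrderIso u σ = length u ≡ length σ ×
  (∀ s t → s < t → t < length u → (at u s > at u t) ⇔ (at σ s > at σ t))

Contains : List ℕ → List ℕ → Set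
Contains w σ = ∃[ u ] (u ⊆ w × OrderIso u σ)

Avoids : List ℕ → List ℕ → Set
Avoids w σ = Contains w σ → Data.Empty.⊥
  where import Data.Empty

oneLine : {n : ℕ} → Vec (Fin n) n → List ℕ
oneLine v = map toℕ (toList v)

cycleSeq : {n : ℕ} → Vec (Fin n) n → List ℕ
cycleSeq v = map toℕ (cycleForm v)

InA : {n : ℕ} → Vec (Fin n) n → Set
InA v = IsCyclic v
      × Avoids (oneLine v) (1 ∷ 3 ∷ 2 ∷ 4 ∷ [])
      × Avoids (oneLine v) (1 ∷ 4 ∷ 2 ∷ 3 ∷ [])
      × Avoids (cycleSeq v) (2 ∷ 1 ∷ 3 ∷ [])

-- membership in A_n(1324,1423;213)|_2^n : additionally c_n = 2 (0-based value 1)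
InA2n : {n : ℕ} → Vec (Fin n) n → Set
InA2n v = InA v × last (cycleSeq v) ≡ just 1

HasCard : {A : Set} → (A → Set) → ℕ → Set
HasCard {A} P k = ∃[ L ] (Unique L × (∀ (x : A) → (x ∈ L) ⇔ P x) × length L ≡ k)
  where open import Data.List.Membership.Propositional using (_∈_)

-- Write P for the one-line notation and C for the standard cycle form, both 0-based on [0, m]
-- with m = n − 1, and K = C 1 = P 0.  Since the cycle ends with c_n = 2, P 1 = 0; hence P has
-- no valley P j < P i, P l at positions 2 ≤ i < j < l, for together with position 1 it would
-- form a 1324 or a 1423.  Avoiding 213, the cycle has all its values below K after its maximum
-- m, and increases up to m.  No valleys then force P x = x − 1 on [1, K) and P m = K − 1, so
-- the cycle ends m, K − 1, …, 1, and the increasing part before m must be K, K + 1, …, m.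
-- Thus a member is determined by K ∈ [2, m]; conversely every such K gives a member, whose
-- cycle increases and then decreases and whose one-line notation increases strictly between
-- its first and last entries.

{-# OPTIONS --safe #-}
module Submission where

open import Defs
open import Data.Nat
open import Data.Nat.Properties
open import Data.Nat.DivMod using (_mod_; _%_; m<n⇒m%n≡m)
open import Data.Fin as Fin using (Fin; toℕ; fromℕ<; punchOut)
import Data.Fin.Properties as Fin
open import Data.Vec as Vec using (Vec; lookup; toList)
import Data.Vec.Properties as Vec
open import Data.List as List using (List; []; _∷_; length; map; last; drop; iterate; applyUpTo; _++_)
open import Data.List.Properties using (length-map; length-iterate; length-++; length-applyUpTo)
open import Data.List.Membership.Propositional using (_∈_)
open import Data.List.Membership.Propositional.Properties using (∈-lookup; ∈-applyUpTo⁺; ∈-applyUpTo⁻)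
import Data.List.Membership.DecPropositional as DecMembership
open import Data.List.Relation.Unary.Any using (here; there)
open import Data.List.Relation.Unary.All as All using (All; []; _∷_)
import Data.List.Relation.Unary.All.Properties as AllP
open import Data.List.Relation.Unary.AllPairs as AllPairs using (AllPairs; []; _∷_)
import Data.List.Relation.Unary.AllPairs.Properties as AllPairsP
open import Data.List.Relation.Unary.Linked using (Linked; []; [-]; _∷_)
open import Data.List.Relation.Unary.Linked.Properties using (Linked⇒AllPairs)
open import Data.List.Relation.Unary.Unique.Propositional using (Unique)
import Data.List.Relation.Unary.Unique.Propositional.Properties as Unique
open import Data.List.Relation.Binary.Sublist.Propositional using (_⊆_; []; _∷_; _∷ʳ_; minimum)
open import Data.List.Relation.Binary.Sublist.Propositional.Properties using (All-resp-⊆; ∷⁻)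
open import Data.Maybe using (just)
open import Data.Product using (∃-syntax; ∃₂; _×_; _,_; proj₁; proj₂)
open import Data.Sum using (_⊎_; inj₁; inj₂)
open import Data.Empty using (⊥; ⊥-elim)
open import Function using (_∘_; _⇔_; mk⇔; Equivalence)
open import Relation.Binary.Definitions using (tri<; tri≈; tri>)
open import Relation.Binary.PropositionalEquality
open import Relation.Nullary using (contradiction; yes; no)
open import Relation.Nullary.Decidable using (True; toWitness; _×-dec_)

strictlyIncreasing-tight : ∀ (f : ℕ → ℕ) d → (∀ i → i < d → f i < f (suc i)) →
                           f d ≤ f 0 + d → ∀ i → i ≤ d → f i ≡ f 0 + i
strictlyIncreasing-tight f d f-inc fd≤ i i≤d = ≤-antisym upper (gap 0 i i≤d)
  where
    gap : ∀ a j → a + j ≤ d → f a + j ≤ f (a + j)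
    gap a zero _ rewrite +-identityʳ a | +-identityʳ (f a) = ≤-refl
    gap a (suc j) a+1+j≤d rewrite +-suc (f a) j | +-suc a j =
      ≤-<-trans (gap a j (<⇒≤ a+1+j≤d)) (f-inc (a + j) a+1+j≤d)
    j = d ∸ i
    i+j≡d : i + j ≡ d
    i+j≡d = m+[n∸m]≡n i≤d
    upper : f i ≤ f 0 + i
    upper = +-cancelʳ-≤ j (f i) (f 0 + i) (begin
      f i + j       ≤⟨ gap i j (≤-reflexive i+j≡d) ⟩
      f (i + j)     ≡⟨ cong f i+j≡d ⟩
      f d           ≤⟨ fd≤ ⟩
      f 0 + d       ≡⟨ cong (f 0 +_) (sym i+j≡d) ⟩
      f 0 + (i + j) ≡⟨ +-assoc (f 0) i j ⟨
      f 0 + i + j   ∎)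
      where open ≤-Reasoning

at-∈ : ∀ {xs i} → i < length xs → at xs i ∈ xs
at-∈ {_ ∷ _} {zero}  _        = here refl
at-∈ {_ ∷ _} {suc i} (s≤s i<) = there (at-∈ i<)

at-map : ∀ (f : ℕ → ℕ) {xs i} → i < length xs → at (map f xs) i ≡ f (at xs i)
at-map f {_ ∷ _} {zero}  _        = refl
at-map f {_ ∷ xs} {suc i} (s≤s i<) = at-map f {xs} i<

at-++ˡ : ∀ xs {ys i} → i < length xs → at (xs ++ ys) i ≡ at xs i
at-++ˡ (_ ∷ _)  {i = zero}  _        = refl
at-++ˡ (_ ∷ xs) {i = suc i} (s≤s i<) = at-++ˡ xs i<

at-++ʳ : ∀ xs {ys i j} → i ≡ length xs + j → at (xs ++ ys) i ≡ at ys j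
at-++ʳ []       refl = refl
at-++ʳ (_ ∷ xs) refl = at-++ʳ xs refl

at-iterate-suc : ∀ a {k i} → i < k → at (iterate suc a k) i ≡ a + i
at-iterate-suc a {suc _} {zero}  _        = sym (+-identityʳ a)
at-iterate-suc a {suc _} {suc i} (s≤s i<) = trans (at-iterate-suc (suc a) i<) (sym (+-suc a i))

at-iterate-step : ∀ f x {n t} → suc t < n → at (iterate f x n) (suc t) ≡ f (at (iterate f x n) t)
at-iterate-step f x {suc (suc _)} {zero}  _        = refl
at-iterate-step f x {suc _}       {suc t} (s≤s t<) = at-iterate-step f (f x) t<

at-last : ∀ xs {a n} → last xs ≡ just a → length xs ≡ suc n → at xs n ≡ a
at-last (_ ∷ [])     {n = zero}  refl _     = refl
at-last (_ ∷ y ∷ xs) {n = suc n} eq   len   = at-last (y ∷ xs) eq (suc-injective len)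

at-injective : ∀ {xs} → Unique xs → ∀ {i j} → i < length xs → j < length xs → at xs i ≡ at xs j → i ≡ j
at-injective {_ ∷ _}  (_  ∷ _)  {zero}  {zero}  _        _        _  = refl
at-injective {_ ∷ _}  (x∉ ∷ _)  {zero}  {suc j} _        (s≤s j<) eq = ⊥-elim (All.lookup x∉ (at-∈ j<) eq)
at-injective {_ ∷ _}  (x∉ ∷ _)  {suc i} {zero}  (s≤s i<) _        eq = ⊥-elim (All.lookup x∉ (at-∈ i<) (sym eq))
at-injective {_ ∷ xs} (_  ∷ u)  {suc i} {suc j} (s≤s i<) (s≤s j<) eq = cong suc (at-injective u i< j< eq)

at-extensional : ∀ {xs ys} → length xs ≡ length ys → (∀ i → i < length xs → at xs i ≡ at ys i) → xs ≡ ys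
at-extensional {[]}     {[]}     _   _  = refl
at-extensional {x ∷ xs} {y ∷ ys} len eq =
  cong₂ _∷_ (eq 0 (s≤s z≤n)) (at-extensional (suc-injective len) (λ i i< → eq (suc i) (s≤s i<)))

at-toℕ-≤ : ∀ {m} (xs : List (Fin (suc m))) t → at (map toℕ xs) t ≤ m
at-toℕ-≤ []       _       = z≤n
at-toℕ-≤ (x ∷ _)  zero    = s≤s⁻¹ (Fin.toℕ<n x)
at-toℕ-≤ (_ ∷ xs) (suc t) = at-toℕ-≤ xs t

at-toℕ-toList : ∀ {k n} (v : Vec (Fin k) n) i → at (map toℕ (toList v)) (toℕ i) ≡ toℕ (lookup v i)
at-toℕ-toList (_ Vec.∷ _) Fin.zero    = refl
at-toℕ-toList (_ Vec.∷ v) (Fin.suc i) = at-toℕ-toList v i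

∈⇒at : ∀ {n} {xs : List (Fin n)} {y} → y ∈ xs → ∃[ t ] t < length xs × at (map toℕ xs) t ≡ toℕ y
∈⇒at (here refl) = zero , s≤s z≤n , refl
∈⇒at (there y∈)  with ∈⇒at y∈
... | t , t< , eq = suc t , s≤s t< , eq

Unique⇒lookup-injective : ∀ {A : Set} {xs : List A} → Unique xs →
                          ∀ i j → List.lookup xs i ≡ List.lookup xs j → i ≡ j
Unique⇒lookup-injective {xs = _ ∷ _} (_  ∷ _) Fin.zero    Fin.zero    _  = refl
Unique⇒lookup-injective {xs = _ ∷ _} (x∉ ∷ _) Fin.zero    (Fin.suc j) eq = ⊥-elim (All.lookup x∉ (∈-lookup j) eq)
Unique⇒lookup-injective {xs = _ ∷ _} (x∉ ∷ _) (Fin.suc i) Fin.zero    eq = ⊥-elim (All.lookup x∉ (∈-lookup i) (sym eq))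
Unique⇒lookup-injective {xs = _ ∷ _} (_  ∷ u) (Fin.suc i) (Fin.suc j) eq =
  cong Fin.suc (Unique⇒lookup-injective u i j eq)

-- If y were missing, punching it out would inject the n positions of xs into Fin (n − 1).
Unique-full : ∀ {n} {xs : List (Fin n)} → Unique xs → length xs ≡ n → ∀ y → y ∈ xs
Unique-full {suc n} {xs} u len y with DecMembership._∈?_ Fin._≟_ y xs
... | yes y∈ = y∈
... | no  y∉ = contradiction (Fin.injective⇒≤ skip-y-injective) (subst (_≰ n) (sym len) (<-irrefl refl))
  where
    y≢ : ∀ i → y ≢ List.lookup xs i
    y≢ i eq = y∉ (subst (_∈ xs) (sym eq) (∈-lookup i))
    skip-y : Fin (length xs) → Fin n
    skip-y i = punchOut (y≢ i)
    skip-y-injective : ∀ {i j} → skip-y i ≡ skip-y j → i ≡ j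
    skip-y-injective {i} {j} eq = Unique⇒lookup-injective u i j (Fin.punchOut-injective (y≢ i) (y≢ j) eq)

-- Occurrences of patterns

AllPairs-resp-⊇ : ∀ {R : ℕ → ℕ → Set} {xs ys} → xs ⊆ ys → AllPairs R ys → AllPairs R xs
AllPairs-resp-⊇ []          []         = []
AllPairs-resp-⊇ (_ ∷ʳ xs⊆)  (_  ∷ pys) = AllPairs-resp-⊇ xs⊆ pys
AllPairs-resp-⊇ (refl ∷ xs⊆) (py ∷ pys) = All-resp-⊆ xs⊆ py ∷ AllPairs-resp-⊇ xs⊆ pys

⊆-++⁻ : ∀ {xs : List ℕ} ys {zs} → xs ⊆ ys ++ zs → ∃₂ λ as bs → xs ≡ as ++ bs × as ⊆ ys × bs ⊆ zs
⊆-++⁻ []       xs⊆ = [] , _ , refl , [] , xs⊆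
⊆-++⁻ (y ∷ ys) (.y ∷ʳ xs⊆) with ⊆-++⁻ ys xs⊆
... | as , bs , refl , as⊆ , bs⊆ = as , bs , refl , y ∷ʳ as⊆ , bs⊆
⊆-++⁻ (y ∷ ys) (refl ∷ xs⊆) with ⊆-++⁻ ys xs⊆
... | as , bs , refl , as⊆ , bs⊆ = y ∷ as , bs , refl , refl ∷ as⊆ , bs⊆

at∷⊆drop : ∀ w {k i xs} → k ≤ i → i < length w → xs ⊆ drop (suc i) w → at w i ∷ xs ⊆ drop k w
at∷⊆drop (x ∷ w) {zero}  {zero}  _        _        xs⊆ = refl ∷ xs⊆
at∷⊆drop (x ∷ w) {zero}  {suc i} _        (s≤s i<) xs⊆ = x ∷ʳ at∷⊆drop w z≤n i< xs⊆
at∷⊆drop (x ∷ w) {suc k} {suc i} (s≤s k≤i) (s≤s i<) xs⊆ = at∷⊆drop w k≤i i< xs⊆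

-- Appending length w to the indices says that they are in range.
map-at-⊆ : ∀ w {is} → Linked _<_ (is ++ length w ∷ []) → map (at w) is ⊆ w
map-at-⊆ w {is} sorted = go 0 is (All.universal (λ _ → z≤n) is) (Linked⇒AllPairs <-trans sorted)
  where
    go : ∀ k is → All (k ≤_) is → AllPairs _<_ (is ++ length w ∷ []) → map (at w) is ⊆ drop k w
    go k []       _         _                = minimum _
    go k (i ∷ is) (k≤i ∷ _) (i<later ∷ sorted) =
      at∷⊆drop w k≤i (All.head (AllP.++⁻ʳ is i<later)) (go (suc i) is (AllP.++⁻ˡ is i<later) sorted)

at-strictMono : ∀ {r} → AllPairs _<_ r → ∀ {i j} → i < j → j < length r → at r i < at r j
at-strictMono {_ ∷ _}  (x< ∷ _)     {zero}  {suc j} _         (s≤s j<) = All.lookup x< (at-∈ j<)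
at-strictMono {_ ∷ _}  (_  ∷ sorted) {suc i} {suc j} (s≤s i<j) (s≤s j<) = at-strictMono sorted i<j j<

at-<-⇔ : ∀ {r} → AllPairs _<_ r → ∀ {i j} → i < length r → j < length r → (at r j < at r i ⇔ j < i)
at-<-⇔ {r} sorted {i} {j} i< j< = mk⇔ to (λ j<i → at-strictMono sorted j<i i<)
  where
    to : at r j < at r i → j < i
    to rj<ri with <-cmp i j
    ... | tri< i<j _ _ = contradiction (at-strictMono sorted i<j j<) (<-asym rj<ri)
    ... | tri≈ _ refl _ = contradiction rj<ri (<-irrefl refl)
    ... | tri> _ _ j<i = j<i

-- σ lists the ranks 1, …, |r| of the entries and r the entries in increasing order; the side
-- condition on σ is decided by normalisation.
orderIso-rank : ∀ r σ → Linked _<_ r → {True (All.all? (λ x → (1 ≤? x) ×-dec (x ≤? length r)) σ)} →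
                OrderIso (map (at (0 ∷ r)) σ) σ
orderIso-rank r σ linked {ranks} = length-map _ σ , iso
  where
    g = at (0 ∷ r)
    rank-⇔ : ∀ {x y} → 1 ≤ x × x ≤ length r → 1 ≤ y × y ≤ length r → (g y < g x ⇔ y < x)
    rank-⇔ {suc i} {suc j} (_ , i<) (_ , j<) with at-<-⇔ (Linked⇒AllPairs <-trans linked) i< j<
    ... | rj<ri⇔j<i = mk⇔ (s≤s ∘ Equivalence.to rj<ri⇔j<i) (Equivalence.from rj<ri⇔j<i ∘ s≤s⁻¹)
    in-range : ∀ {s} → s < length σ → 1 ≤ at σ s × at σ s ≤ length r
    in-range s< = All.lookup (toWitness ranks) (at-∈ s<)
    iso : ∀ s t → s < t → t < length (map g σ) → (at (map g σ) s > at (map g σ) t) ⇔ (at σ s > at σ t)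
    iso s t s<t t< = subst₂ (λ a b → (b < a) ⇔ (at σ t < at σ s))
                       (sym (at-map g {σ} s<σ)) (sym (at-map g {σ} t<σ)) (rank-⇔ (in-range s<σ) (in-range t<σ))
      where
        t<σ = subst (t <_) (length-map g σ) t<
        s<σ = <-trans s<t t<σ

first<second : ∀ {x y a b : ℕ} {xs as bs} → _≡_ {A = List ℕ} (x ∷ y ∷ xs) ((a ∷ b ∷ as) ++ bs) →
               AllPairs _<_ (a ∷ b ∷ as) → x < y
first<second refl ((a<b ∷ _) ∷ _) = a<b

increasing++decreasing-no-213 : ∀ {U D x y z} → AllPairs _<_ U → AllPairs _>_ D →
                                x ∷ y ∷ z ∷ [] ⊆ U ++ D → y < x → x ≤ z → ⊥
increasing++decreasing-no-213 {U} incr decr xyz⊆ y<x x≤z with ⊆-++⁻ U xyz⊆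
... | []        , _ , refl , _   , xyz⊆D = no-yz (AllPairs-resp-⊇ xyz⊆D decr)
  where no-yz : AllPairs _>_ (_ ∷ _ ∷ _ ∷ []) → ⊥
        no-yz (_ ∷ (z<y ∷ []) ∷ _) = <-irrefl refl (<-≤-trans (<-trans z<y y<x) x≤z)
... | _ ∷ []    , _ , refl , _   , yz⊆D = no-yz (AllPairs-resp-⊇ yz⊆D decr)
  where no-yz : AllPairs _>_ (_ ∷ _ ∷ []) → ⊥
        no-yz ((z<y ∷ []) ∷ _) = <-irrefl refl (<-≤-trans (<-trans z<y y<x) x≤z)
... | _ ∷ _ ∷ _ , _ , eq , xy⊆U , _ = <-asym (first<second eq (AllPairs-resp-⊇ xy⊆U incr)) y<x

increasing++decreasing-avoids-213 : ∀ {U D} → AllPairs _<_ U → AllPairs _>_ D → Avoids (U ++ D) (2 ∷ 1 ∷ 3 ∷ [])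
increasing++decreasing-avoids-213 incr decr (_ ∷ _ ∷ _ ∷ [] , xyz⊆ , _ , iso) =
  increasing++decreasing-no-213 incr decr xyz⊆
    (Equivalence.from (iso 0 1 (s≤s z≤n) (s≤s (s≤s z≤n))) (s≤s (s≤s z≤n)))
    (≮⇒≥ λ z<x → contradiction (Equivalence.to (iso 0 2 (s≤s z≤n) (s≤s (s≤s (s≤s z≤n)))) z<x)
                                λ { (s≤s (s≤s ())) })
increasing++decreasing-avoids-213 incr decr ([]                  , _ , () , _)
increasing++decreasing-avoids-213 incr decr (_ ∷ []              , _ , () , _)
increasing++decreasing-avoids-213 incr decr (_ ∷ _ ∷ []          , _ , () , _)
increasing++decreasing-avoids-213 incr decr (_ ∷ _ ∷ _ ∷ _ ∷ _   , _ , () , _)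

-- The two middle entries of an occurrence lie inside the increasing run I.
increasing-inside-avoids : ∀ {h I z σ₁ σ₂ σ₃ σ₄} → AllPairs _<_ I → σ₃ < σ₂ →
                           Avoids (h ∷ I ++ z ∷ []) (σ₁ ∷ σ₂ ∷ σ₃ ∷ σ₄ ∷ [])
increasing-inside-avoids {I = I} incr σ₃<σ₂ (a ∷ b ∷ c ∷ d ∷ [] , abcd⊆ , _ , iso)
  with ⊆-++⁻ I (∷⁻ abcd⊆)
... | _ ∷ _ ∷ _ , _ , eq , bc⊆I , _ =
  <-asym (first<second eq (AllPairs-resp-⊇ bc⊆I incr))
         (Equivalence.from (iso 1 2 (s≤s (s≤s z≤n)) (s≤s (s≤s (s≤s z≤n)))) σ₃<σ₂)
... | []     , _ , refl , _ , (_ ∷ʳ ())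
... | []     , _ , refl , _ , (refl ∷ ())
... | _ ∷ [] , _ , refl , _ , (_ ∷ʳ ())
... | _ ∷ [] , _ , refl , _ , (refl ∷ ())
increasing-inside-avoids _ _ ([]                , _ , () , _)
increasing-inside-avoids _ _ (_ ∷ []            , _ , () , _)
increasing-inside-avoids _ _ (_ ∷ _ ∷ []        , _ , () , _)
increasing-inside-avoids _ _ (_ ∷ _ ∷ _ ∷ []    , _ , () , _)
increasing-inside-avoids _ _ (_ ∷ _ ∷ _ ∷ _ ∷ _ ∷ _ , _ , () , _)

-- Membership in A_n(1324,1423;213)|_2^n for n = m + 1, with the one-line notation P and the cycle
-- sequence C read as functions on [0, m]; values are 0-based, so c_n = 2 becomes C m ≡ 1.
record InA2nFun (m : ℕ) (P C : ℕ → ℕ) : Set where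
  field
    P-injective   : ∀ {x y} → x ≤ m → y ≤ m → P x ≡ P y → x ≡ y
    P-≤           : ∀ {x} → x ≤ m → P x ≤ m
    C-zero        : C 0 ≡ 0
    C-suc         : ∀ {t} → t < m → C (suc t) ≡ P (C t)
    C-injective   : ∀ {s t} → s ≤ m → t ≤ m → C s ≡ C t → s ≡ t
    C-≤           : ∀ {t} → t ≤ m → C t ≤ m
    C-surjective  : ∀ {y} → y ≤ m → ∃[ t ] t ≤ m × C t ≡ y
    C-last        : C m ≡ 1
    C-avoids-213  : ∀ {a b c} → a < b → b < c → c ≤ m → C b < C a → C a < C c → ⊥
    P-avoids-1324 : ∀ {i j k l} → i < j → j < k → k < l → l ≤ m →
                    P i < P k → P k < P j → P j < P l → ⊥
    P-avoids-1423 : ∀ {i j k l} → i < j → j < k → k < l → l ≤ m →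
                    P i < P k → P k < P l → P l < P j → ⊥

orbit-iterate : ∀ {n} (v : Vec (Fin n) n) c k → map toℕ (orbit v c k) ≡ iterate (at (oneLine v)) (toℕ c) k
orbit-iterate v c zero    = refl
orbit-iterate v c (suc k) = cong (toℕ c ∷_) (begin
  map toℕ (orbit v (lookup v c) k)            ≡⟨ orbit-iterate v (lookup v c) k ⟩
  iterate P (toℕ (lookup v c)) k              ≡⟨ cong (λ x → iterate P x k) (at-toℕ-toList v c) ⟨
  iterate P (P (toℕ c)) k                     ∎)
  where
    open ≡-Reasoning
    P = at (oneLine v)

length-oneLine : ∀ {n} (v : Vec (Fin n) n) → length (oneLine v) ≡ n
length-oneLine v = trans (length-map toℕ (toList v)) (Vec.length-toList v)

module _ {m : ℕ} (v : Vec (Fin (suc m)) (suc m)) where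

  private
    P = at (oneLine v)
    C = at (cycleSeq v)

  cycleSeq-iterate : cycleSeq v ≡ iterate P 0 (suc m)
  cycleSeq-iterate = orbit-iterate v Fin.zero (suc m)

  length-cycleSeq : length (cycleSeq v) ≡ suc m
  length-cycleSeq = trans (cong length cycleSeq-iterate) (length-iterate P 0 (suc m))

  at-oneLine : ∀ {x} (x<1+m : x < suc m) → P x ≡ toℕ (lookup v (fromℕ< x<1+m))
  at-oneLine x<1+m = trans (cong P (sym (Fin.toℕ-fromℕ< x<1+m))) (at-toℕ-toList v _)

  InA2n⇒InA2nFun : InA2n v → InA2nFun m P C
  InA2n⇒InA2nFun (((isPerm , unique) , avoids-1324 , avoids-1423 , avoids-213) , last≡2) = record
    { P-injective   = P-injective
    ; P-≤           = λ {x} _ → at-toℕ-≤ (toList v) x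
    ; C-zero        = refl
    ; C-suc         = C-suc
    ; C-injective   = λ s≤m t≤m →
        at-injective (Unique.map⁺ Fin.toℕ-injective unique) (<length s≤m) (<length t≤m)
    ; C-≤           = λ {t} _ → at-toℕ-≤ (cycleForm v) t
    ; C-surjective  = C-surjective
    ; C-last        = at-last (cycleSeq v) last≡2 length-cycleSeq
    ; C-avoids-213  = C-avoids-213
    ; P-avoids-1324 = P-avoids-1324
    ; P-avoids-1423 = P-avoids-1423
    }
    where
      <length : ∀ {t} → t ≤ m → t < length (cycleSeq v)
      <length {t} t≤m = subst (t <_) (sym length-cycleSeq) (s≤s t≤m)

      <length₁ : ∀ {t} → t ≤ m → t < length (oneLine v)
      <length₁ {t} t≤m = subst (t <_) (sym (length-oneLine v)) (s≤s t≤m)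

      P-injective : ∀ {x y} → x ≤ m → y ≤ m → P x ≡ P y → x ≡ y
      P-injective {x} {y} x≤m y≤m Px≡Py = begin
        x                          ≡⟨ Fin.toℕ-fromℕ< (s≤s x≤m) ⟨
        toℕ (fromℕ< (s≤s x≤m))     ≡⟨ cong toℕ (isPerm _ _ (Fin.toℕ-injective lookups≡)) ⟩
        toℕ (fromℕ< (s≤s y≤m))     ≡⟨ Fin.toℕ-fromℕ< (s≤s y≤m) ⟩
        y                          ∎
        where
          open ≡-Reasoning
          lookups≡ = trans (sym (at-oneLine (s≤s x≤m))) (trans Px≡Py (at-oneLine (s≤s y≤m)))

      C-suc : ∀ {t} → t < m → C (suc t) ≡ P (C t)
      C-suc {t} t<m = subst (λ w → at w (suc t) ≡ P (at w t)) (sym cycleSeq-iterate)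
                            (at-iterate-step P 0 (s≤s t<m))

      length-cycleForm : length (cycleForm v) ≡ suc m
      length-cycleForm = trans (sym (length-map toℕ (cycleForm v))) length-cycleSeq

      C-surjective : ∀ {y} → y ≤ m → ∃[ t ] t ≤ m × C t ≡ y
      C-surjective {y} y≤m with ∈⇒at (Unique-full unique length-cycleForm (fromℕ< (s≤s y≤m)))
      ... | t , t< , Ct≡ =
        t , s≤s⁻¹ (subst (t <_) length-cycleForm t<) , trans Ct≡ (Fin.toℕ-fromℕ< (s≤s y≤m))

      C-avoids-213 : ∀ {a b c} → a < b → b < c → c ≤ m → C b < C a → C a < C c → ⊥
      C-avoids-213 {a} {b} {c} a<b b<c c≤m Cb<Ca Ca<Cc = avoids-213
        ( _ , map-at-⊆ (cycleSeq v) (a<b ∷ b<c ∷ <length c≤m ∷ [-])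
        , orderIso-rank (C b ∷ C a ∷ C c ∷ []) (2 ∷ 1 ∷ 3 ∷ []) (Cb<Ca ∷ Ca<Cc ∷ [-]))

      P-avoids-1324 : ∀ {i j k l} → i < j → j < k → k < l → l ≤ m → P i < P k → P k < P j → P j < P l → ⊥
      P-avoids-1324 {i} {j} {k} {l} i<j j<k k<l l≤m Pi<Pk Pk<Pj Pj<Pl = avoids-1324
        ( _ , map-at-⊆ (oneLine v) (i<j ∷ j<k ∷ k<l ∷ <length₁ l≤m ∷ [-])
        , orderIso-rank (P i ∷ P k ∷ P j ∷ P l ∷ []) (1 ∷ 3 ∷ 2 ∷ 4 ∷ []) (Pi<Pk ∷ Pk<Pj ∷ Pj<Pl ∷ [-]))

      P-avoids-1423 : ∀ {i j k l} → i < j → j < k → k < l → l ≤ m → P i < P k → P k < P l → P l < P j → ⊥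
      P-avoids-1423 {i} {j} {k} {l} i<j j<k k<l l≤m Pi<Pk Pk<Pl Pl<Pj = avoids-1423
        ( _ , map-at-⊆ (oneLine v) (i<j ∷ j<k ∷ k<l ∷ <length₁ l≤m ∷ [-])
        , orderIso-rank (P i ∷ P k ∷ P l ∷ P j ∷ []) (1 ∷ 4 ∷ 2 ∷ 3 ∷ []) (Pi<Pk ∷ Pk<Pl ∷ Pl<Pj ∷ [-]))

-- Permutations with a unimodal cycle

-- P is the permutation of [0, m] with cycle (0, K, K + 1, …, m, K − 1, …, 1).
record UnimodalCycle (m K : ℕ) (P : ℕ → ℕ) : Set where
  field
    2≤K     : 2 ≤ K
    K≤m     : K ≤ m
    P-zero  : P 0 ≡ K
    P-below : ∀ x → 1 ≤ x → x < K → P x ≡ pred x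
    P-above : ∀ x → K ≤ x → x < m → P x ≡ suc x
    P-last  : P m ≡ pred K

data Region (m K x : ℕ) : Set where
  origin : x ≡ 0 → Region m K x
  below  : 1 ≤ x → x < K → Region m K x
  above  : K ≤ x → x < m → Region m K x
  end    : x ≡ m → Region m K x

region : ∀ {m} K {x} → x ≤ m → Region m K x
region K {zero}      _   = origin refl
region K {x@(suc _)} x≤m with x <? K | m≤n⇒m<n∨m≡n x≤m
... | yes x<K | _        = below (s≤s z≤n) x<K
... | no  x≮K | inj₁ x<m = above (≮⇒≥ x≮K) x<m
... | no  _   | inj₂ x≡m = end x≡m

module _ {m K : ℕ} {P : ℕ → ℕ} (U : UnimodalCycle m K P) where
  open UnimodalCycle U

  UnimodalCycle-≤ : ∀ {x} → x ≤ m → P x ≤ m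
  UnimodalCycle-≤ {x} x≤m with region K x≤m
  ... | origin refl   = subst (_≤ m) (sym P-zero) K≤m
  ... | below 1≤x x<K = subst (_≤ m) (sym (P-below x 1≤x x<K)) (≤-trans pred[n]≤n x≤m)
  ... | above K≤x x<m = subst (_≤ m) (sym (P-above x K≤x x<m)) x<m
  ... | end refl      = subst (_≤ m) (sym P-last) (≤-trans pred[n]≤n K≤m)

  UnimodalCycle-unique : ∀ {Q} → UnimodalCycle m K Q → ∀ {x} → x ≤ m → P x ≡ Q x
  UnimodalCycle-unique V {x} x≤m with region K x≤m
  ... | origin refl   = trans P-zero (sym (UnimodalCycle.P-zero V))
  ... | below 1≤x x<K = trans (P-below x 1≤x x<K) (sym (UnimodalCycle.P-below V x 1≤x x<K))
  ... | above K≤x x<m = trans (P-above x K≤x x<m) (sym (UnimodalCycle.P-above V x K≤x x<m))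
  ... | end refl      = trans P-last (sym (UnimodalCycle.P-last V))

-- Every member has a unimodal cycle

module Forward {m : ℕ} {P C : ℕ → ℕ} (2≤m : 2 ≤ m) (A : InA2nFun m P C) where
  open InA2nFun A

  1≤m : 1 ≤ m
  1≤m = <⇒≤ 2≤m

  P-one : P 1 ≡ 0
  P-one with C-surjective (P-≤ 1≤m)
  ... | zero  , _   , C0≡P1 = trans (sym C0≡P1) C-zero
  ... | suc t , t<m , Ct+1≡P1 = contradiction t≡m (<⇒≢ t<m)
    where
      Ct≡1 : C t ≡ 1
      Ct≡1 = P-injective (C-≤ (<⇒≤ t<m)) 1≤m (trans (sym (C-suc t<m)) Ct+1≡P1)
      t≡m : t ≡ m
      t≡m = C-injective (<⇒≤ t<m) ≤-refl (trans Ct≡1 (sym C-last))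

  P1<P : ∀ {x} → 2 ≤ x → x ≤ m → P 1 < P x
  P1<P {x} 2≤x x≤m = subst (_< P x) (sym P-one) (n≢0⇒n>0 λ Px≡0 →
    <⇒≢ 2≤x (sym (P-injective x≤m 1≤m (trans Px≡0 (sym P-one)))))

  K : ℕ
  K = C 1

  P-zero : P 0 ≡ K
  P-zero = sym (trans (C-suc 1≤m) (cong P C-zero))

  K≤m : K ≤ m
  K≤m = C-≤ 1≤m

  2≤K : 2 ≤ K
  2≤K with K in K≡
  ... | 0           = contradiction (C-injective 1≤m z≤n (trans K≡ (sym C-zero))) λ ()
  ... | 1           = contradiction (C-injective 1≤m ≤-refl (trans K≡ (sym C-last))) (<⇒≢ 2≤m)
  ... | suc (suc _) = s≤s (s≤s z≤n)

  1≤K-1 : 1 ≤ pred K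
  1≤K-1 = pred-mono-≤ 2≤K

  1+K-1≡K : suc (pred K) ≡ K
  1+K-1≡K = suc-pred K {{>-nonZero (<⇒≤ 2≤K)}}

  K-1<K : pred K < K
  K-1<K = ≤-reflexive 1+K-1≡K

  <K⇒≤m : ∀ {v} → v < K → v ≤ m
  <K⇒≤m v<K = ≤-trans (<⇒≤ v<K) K≤m

  -- Since P 1 = 0, the entries at positions 1, i, j, l would form a 1324 or a 1423.
  no-valley : ∀ {i j l} → 2 ≤ i → i < j → j < l → l ≤ m → P j < P i → P j < P l → ⊥
  no-valley {i} {j} {l} 2≤i i<j j<l l≤m Pj<Pi Pj<Pl
    with <-cmp (P i) (P l) | P1<P (≤-trans 2≤i (<⇒≤ i<j)) (≤-trans (<⇒≤ j<l) l≤m)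
  ... | tri< Pi<Pl _ _ | P1<Pj = P-avoids-1324 2≤i i<j j<l l≤m P1<Pj Pj<Pi Pi<Pl
  ... | tri≈ _ Pi≡Pl _ | _     =
    <⇒≢ (<-trans i<j j<l) (P-injective (≤-trans (<⇒≤ (<-trans i<j j<l)) l≤m) l≤m Pi≡Pl)
  ... | tri> _ _ Pl<Pi | P1<Pj = P-avoids-1423 2≤i i<j j<l l≤m P1<Pj Pj<Pl Pl<Pi

  C-stays-below-K : ∀ {s t} → 1 ≤ s → s < t → t ≤ m → C s < K → C t < K
  C-stays-below-K {s} {t} 1≤s s<t t≤m Cs<K with <-cmp (C t) K
  ... | tri< Ct<K _ _ = Ct<K
  ... | tri≈ _ Ct≡K _ = contradiction (sym (C-injective t≤m 1≤m Ct≡K)) (<⇒≢ (≤-<-trans 1≤s s<t))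
  ... | tri> _ _ K<Ct = ⊥-elim (C-avoids-213 1<s s<t t≤m Cs<K K<Ct)
    where
      1<s : 1 < s
      1<s = ≤∧≢⇒< 1≤s λ 1≡s → <-irrefl (cong C (sym 1≡s)) Cs<K

  top : ℕ
  top = proj₁ (C-surjective ≤-refl)

  top≤m : top ≤ m
  top≤m = proj₁ (proj₂ (C-surjective ≤-refl))

  C-top : C top ≡ m
  C-top = proj₂ (proj₂ (C-surjective ≤-refl))

  top<m : top < m
  top<m = ≤∧≢⇒< top≤m λ top≡m → <⇒≢ 2≤m (trans (sym C-last) (trans (cong C (sym top≡m)) C-top))

  2≤top : K < m → 2 ≤ top
  2≤top K<m with top | C-top
  ... | 0           | C0≡m = contradiction (trans (sym C-zero) C0≡m) (<⇒≢ (<⇒≤ 2≤m))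
  ... | 1           | C1≡m = contradiction C1≡m (<⇒≢ K<m)
  ... | suc (suc _) | _    = s≤s (s≤s z≤n)

  K≤C-before-top : ∀ {t} → 1 ≤ t → t ≤ top → K ≤ C t
  K≤C-before-top 1≤t t≤top with m≤n⇒m<n∨m≡n t≤top
  ... | inj₂ refl  = subst (K ≤_) (sym C-top) K≤m
  ... | inj₁ t<top = ≮⇒≥ λ Ct<K →
    <⇒≱ (subst (_< K) C-top (C-stays-below-K 1≤t t<top top≤m Ct<K)) K≤m

  P-surjective : ∀ {y} → 1 ≤ y → y ≤ m → ∃[ j ] j ≤ m × P j ≡ y
  P-surjective 1≤y y≤m with C-surjective y≤m
  ... | zero  , _     , C0≡y   = contradiction (trans (sym C0≡y) C-zero) (<⇒≢ 1≤y ∘ sym)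
  ... | suc t , t+1≤m , Ct+1≡y = C t , C-≤ (<⇒≤ t+1≤m) , trans (sym (C-suc t+1≤m)) Ct+1≡y

  small-after-top : ∀ {y} → 1 ≤ y → y < K → ∃[ t ] top < t × t ≤ m × C t ≡ y
  small-after-top 1≤y y<K with C-surjective (<K⇒≤m y<K)
  ... | zero  , _     , C0≡y   = contradiction (trans (sym C0≡y) C-zero) (<⇒≢ 1≤y ∘ sym)
  ... | suc t , t+1≤m , Ct+1≡y = suc t , ≰⇒> t+1≰top , t+1≤m , Ct+1≡y
    where
      t+1≰top : suc t ≰ top
      t+1≰top t+1≤top = <⇒≱ y<K (subst (K ≤_) Ct+1≡y (K≤C-before-top (s≤s z≤n) t+1≤top))

  PredUpTo : ℕ → Set
  PredUpTo v = ∀ x → 1 ≤ x → x ≤ v → P x ≡ pred x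

  -- The values below v are taken at the positions 1, …, v.
  P-least-beyond : ∀ {v j x} → PredUpTo v → v < K → j ≤ m → P j ≡ v → x ≤ m → v < x → x ≢ j → P j < P x
  P-least-beyond {v} {j} {x} pred-v v<K j≤m Pj≡v x≤m v<x x≢j with <-cmp (P x) v
  ... | tri< Px<v _ _ = contradiction (subst (_≤ v) (sym x≡1+Px) Px<v) (<⇒≱ v<x)
    where
      x≡1+Px : x ≡ suc (P x)
      x≡1+Px = P-injective x≤m (≤-trans Px<v (<K⇒≤m v<K)) (sym (pred-v (suc (P x)) (s≤s z≤n) Px<v))
  ... | tri≈ _ Px≡v _ = contradiction (P-injective x≤m j≤m (trans Px≡v (sym Pj≡v))) x≢j
  ... | tri> _ _ v<Px = subst (_< P x) (sym Pj≡v) v<Px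

  preimage-beyond : ∀ {v j} → v < K → PredUpTo v → P j ≡ v → v < j
  preimage-beyond {j = zero}  v<K _      Pj≡v = contradiction (trans (sym Pj≡v) P-zero) (<⇒≢ v<K)
  preimage-beyond {j = suc j} _   pred-v Pj≡v = ≰⇒> λ j+1≤v →
    <-irrefl (trans (sym (pred-v (suc j) (s≤s z≤n) j+1≤v)) Pj≡v) j+1≤v

  C-descent : ∀ {t w} → PredUpTo (suc w) → t ≤ m → C t ≡ suc w →
              ∀ i → i ≤ w → t + i ≤ m × C (t + i) + i ≡ suc w
  C-descent {t} _ t≤m Ct≡ zero _ = subst (_≤ m) (sym (+-identityʳ t)) t≤m
                                  , trans (+-identityʳ _) (trans (cong C (+-identityʳ t)) Ct≡)
  C-descent {t} {w} pred-w t≤m Ct≡ (suc i) i+1≤w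
    with C-descent pred-w t≤m Ct≡ i (<⇒≤ i+1≤w)
  ... | t+i≤m , Ct+i+i≡ = subst (_≤ m) (sym (+-suc t i)) t+i<m , (begin
      C (t + suc i) + suc i        ≡⟨ +-suc (C (t + suc i)) i ⟩
      suc (C (t + suc i)) + i      ≡⟨ cong (λ c → suc c + i) C-next ⟩
      suc (pred (C (t + i))) + i   ≡⟨ cong (_+ i) (suc-pred (C (t + i)) {{>-nonZero (<⇒≤ 2≤Ct+i)}}) ⟩
      C (t + i) + i                ≡⟨ Ct+i+i≡ ⟩
      suc w                        ∎)
    where
      open ≡-Reasoning
      2≤Ct+i : 2 ≤ C (t + i)
      2≤Ct+i = +-cancelʳ-≤ i 2 (C (t + i)) (subst (2 + i ≤_) (sym Ct+i+i≡) (s≤s i+1≤w))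
      t+i<m : t + i < m
      t+i<m = ≤∧≢⇒< t+i≤m λ t+i≡m → <-irrefl (trans (sym C-last) (cong C (sym t+i≡m))) 2≤Ct+i
      C-next : C (t + suc i) ≡ pred (C (t + i))
      C-next = begin
        C (t + suc i)      ≡⟨ cong C (+-suc t i) ⟩
        C (suc (t + i))    ≡⟨ C-suc t+i<m ⟩
        P (C (t + i))      ≡⟨ pred-w _ (<⇒≤ 2≤Ct+i) (subst (C (t + i) ≤_) Ct+i+i≡ (m≤m+n _ i)) ⟩
        pred (C (t + i))   ∎

  C-descent-end : ∀ {t w} → PredUpTo (suc w) → t ≤ m → C t ≡ suc w → t + w ≡ m
  C-descent-end {t} {w} pred-w t≤m Ct≡ with C-descent pred-w t≤m Ct≡ w ≤-refl
  ... | t+w≤m , Ct+w+w≡ = C-injective t+w≤m ≤-refl (trans Ct+w≡1 (sym C-last))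
    where
      Ct+w≡1 : C (t + w) ≡ 1
      Ct+w≡1 = +-cancelʳ-≡ w (C (t + w)) 1 Ct+w+w≡

  C-descent-≤ : ∀ {t w t′} → PredUpTo (suc w) → t ≤ m → C t ≡ suc w → t ≤ t′ → t′ ≤ m → C t′ ≤ suc w
  C-descent-≤ {t} {w} pred-w t≤m Ct≡ t≤t′ t′≤m with m≤n⇒∃[o]m+o≡n t≤t′
  ... | i , refl = subst (C (t + i) ≤_) (proj₂ (C-descent pred-w t≤m Ct≡ i i≤w)) (m≤m+n _ i)
    where
      i≤w : i ≤ w
      i≤w = +-cancelˡ-≤ t i w (subst (t + i ≤_) (sym (C-descent-end pred-w t≤m Ct≡)) t′≤m)

  C-after-top-≤ : ∀ {w} → PredUpTo (suc w) → P m ≡ suc w → ∀ {t} → top < t → t ≤ m → C t ≤ suc w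
  C-after-top-≤ pred-w Pm≡ = C-descent-≤ pred-w top<m (trans (C-suc top<m) (trans (cong P C-top) Pm≡))

  -- P j = v with v + 1 < j is impossible: for j < m the positions v + 1, j, m form a valley,
  -- and for j = m the cycle would run m, v, v − 1, …, 1 without ever reaching K − 1 > v.
  pred-step : ∀ {v} → 1 ≤ v → suc v < K → PredUpTo v → P (suc v) ≡ v
  pred-step {v@(suc _)} 1≤v v+1<K pred-v with P-surjective 1≤v (<K⇒≤m (<-trans (n<1+n v) v+1<K))
  ... | j , j≤m , Pj≡v with m≤n⇒m<n∨m≡n (preimage-beyond (<-trans (n<1+n v) v+1<K) pred-v Pj≡v)
  ...   | inj₂ v+1≡j = trans (cong P v+1≡j) Pj≡v
  ...   | inj₁ v+1<j with m≤n⇒m<n∨m≡n j≤m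
  ...     | inj₁ j<m = ⊥-elim (no-valley (s≤s 1≤v) v+1<j j<m ≤-refl
                         (Pj<P (≤-trans (<⇒≤ v+1<j) j≤m) (n<1+n v) (<⇒≢ v+1<j))
                         (Pj<P ≤-refl (<-trans (n<1+n v) (<-trans v+1<j j<m)) (<⇒≢ j<m ∘ sym)))
    where
      Pj<P : ∀ {x} → x ≤ m → v < x → x ≢ j → P j < P x
      Pj<P = P-least-beyond pred-v (<-trans (n<1+n v) v+1<K) j≤m Pj≡v
  ...     | inj₂ refl with small-after-top 1≤K-1 K-1<K
  ...       | p , top<p , p≤m , Cp≡K-1 = contradiction (C-after-top-≤ pred-v Pj≡v top<p p≤m)
                                           (<⇒≱ (subst (v <_) (sym Cp≡K-1) (pred-mono-≤ v+1<K)))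

  pred-upTo : ∀ v → v < K → PredUpTo v
  pred-upTo zero    _     (suc _) _ ()
  pred-upTo (suc v) v+1<K x 1≤x x≤v+1 with m≤n⇒m<n∨m≡n x≤v+1
  ... | inj₁ x<v+1 = pred-upTo v (<-trans (n<1+n v) v+1<K) x 1≤x (s≤s⁻¹ x<v+1)
  ... | inj₂ refl with v
  ...   | zero    = P-one
  ...   | suc v-1 = pred-step (s≤s z≤n) v+1<K (pred-upTo (suc v-1) (<-trans (n<1+n _) v+1<K))

  P-below : ∀ x → 1 ≤ x → x < K → P x ≡ pred x
  P-below x 1≤x x<K = pred-upTo (pred K) K-1<K x 1≤x (pred-mono-≤ x<K)

  -- As in pred-step; now j = K is excluded because C 2 = P K would be a value below K before m.
  P-last : P m ≡ pred K
  P-last with P-surjective 1≤K-1 (<K⇒≤m K-1<K)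
  ... | j , j≤m , Pj≡K-1 with m≤n⇒m<n∨m≡n j≤m
  ...   | inj₂ refl = Pj≡K-1
  ...   | inj₁ j<m with m≤n⇒m<n∨m≡n K≤j
    where
      K≤j : K ≤ j
      K≤j = subst (_≤ j) 1+K-1≡K (preimage-beyond K-1<K (pred-upTo (pred K) K-1<K) Pj≡K-1)
  ...     | inj₁ K<j = ⊥-elim (no-valley 2≤K K<j j<m ≤-refl
                         (Pj<P K≤m K-1<K (<⇒≢ K<j)) (Pj<P ≤-refl (<-≤-trans K-1<K K≤m) (<⇒≢ j<m ∘ sym)))
    where
      Pj<P : ∀ {x} → x ≤ m → pred K < x → x ≢ j → P j < P x
      Pj<P = P-least-beyond (pred-upTo (pred K) K-1<K) K-1<K j≤m Pj≡K-1
  ...     | inj₂ refl = contradiction (K≤C-before-top (s≤s z≤n) (2≤top j<m)) (<⇒≱ C2<K)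
    where
      C2<K : C 2 < K
      C2<K = subst (_< K) (sym (trans (C-suc 2≤m) Pj≡K-1)) K-1<K

  top+K-1≡m : top + pred K ≡ m
  top+K-1≡m with pred K | 1≤K-1 | P-last | pred-upTo (pred K) K-1<K
  ... | suc w | _ | Pm≡ | pred-w =
    trans (+-suc top w) (C-descent-end pred-w top<m (trans (C-suc top<m) (trans (cong P C-top) Pm≡)))

  C<C-top : ∀ {a} → a < top → C a < C top
  C<C-top {a} a<top = subst (C a <_) (sym C-top) (≤∧≢⇒< (C-≤ a≤m) λ Ca≡m →
    <⇒≢ a<top (C-injective a≤m top≤m (trans Ca≡m (sym C-top))))
    where a≤m = ≤-trans (<⇒≤ a<top) top≤m

  -- A descent before the position of the maximum m would be the 21 of a 213.
  C-increasing : ∀ {a b} → a < b → b ≤ top → C a < C b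
  C-increasing {a} {b} a<b b≤top with m≤n⇒m<n∨m≡n b≤top
  ... | inj₂ refl = C<C-top a<b
  ... | inj₁ b<top with <-cmp (C a) (C b)
  ...   | tri< Ca<Cb _ _ = Ca<Cb
  ...   | tri≈ _ Ca≡Cb _ = contradiction (C-injective a≤m b≤m Ca≡Cb) (<⇒≢ a<b)
    where
      b≤m = ≤-trans (<⇒≤ b<top) top≤m
      a≤m = ≤-trans (<⇒≤ a<b) b≤m
  ...   | tri> _ _ Cb<Ca = ⊥-elim (C-avoids-213 a<b b<top top≤m Cb<Ca (C<C-top (<-trans a<b b<top)))

  C-run : ∀ i → i < top → C (suc i) ≡ K + i
  C-run i i<top = strictlyIncreasing-tight (C ∘ suc) d C-inc Cd≤K+d i (s≤s⁻¹ (subst (i <_) top≡1+d i<top))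
    where
      d = pred top
      top≡1+d : top ≡ suc d
      top≡1+d = sym (suc-pred top {{>-nonZero (≤-<-trans z≤n i<top)}})
      C-inc : ∀ j → j < d → C (suc j) < C (suc (suc j))
      C-inc j j<d = C-increasing (n<1+n (suc j)) (subst (suc (suc j) ≤_) (sym top≡1+d) (s≤s j<d))
      Cd≤K+d : C (suc d) ≤ K + d
      Cd≤K+d = ≤-reflexive (begin
        C (suc d)        ≡⟨ cong C (sym top≡1+d) ⟩
        C top            ≡⟨ C-top ⟩
        m                ≡⟨ sym top+K-1≡m ⟩
        top + pred K     ≡⟨ cong (_+ pred K) top≡1+d ⟩
        suc d + pred K   ≡⟨ sym (+-suc d (pred K)) ⟩
        d + suc (pred K) ≡⟨ cong (d +_) 1+K-1≡K ⟩
        d + K            ≡⟨ +-comm d K ⟩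
        K + d            ∎)
        where open ≡-Reasoning

  run-position : ∀ {i} → K + i < m → suc i < top
  run-position {i} K+i<m = +-cancelʳ-< (pred K) (suc i) top (begin-strict
    suc i + pred K     ≡⟨ cong suc (+-comm i (pred K)) ⟩
    suc (pred K + i)   ≡⟨ cong (_+ i) 1+K-1≡K ⟩
    K + i              <⟨ K+i<m ⟩
    m                  ≡⟨ top+K-1≡m ⟨
    top + pred K       ∎)
    where open ≤-Reasoning

  P-above : ∀ x → K ≤ x → x < m → P x ≡ suc x
  P-above x K≤x x<m with m≤n⇒∃[o]m+o≡n K≤x
  ... | i , refl = begin
    P (K + i)         ≡⟨ cong P (C-run i (<-trans (n<1+n i) i+1<top)) ⟨
    P (C (suc i))     ≡⟨ C-suc (<-trans i+1<top top<m) ⟨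
    C (suc (suc i))   ≡⟨ C-run (suc i) i+1<top ⟩
    K + suc i         ≡⟨ +-suc K i ⟩
    suc (K + i)       ∎
    where
      open ≡-Reasoning
      i+1<top = run-position x<m

  unimodal : UnimodalCycle m K P
  unimodal = record
    { 2≤K = 2≤K ; K≤m = K≤m ; P-zero = P-zero
    ; P-below = P-below ; P-above = P-above ; P-last = P-last }

-- Every unimodal cycle gives a member

iterate-suc-bounds : ∀ a k → All (λ y → a ≤ y × y < a + k) (iterate suc a k)
iterate-suc-bounds a zero    = []
iterate-suc-bounds a (suc k) = (≤-refl , subst (a <_) (sym (+-suc a k)) (s≤s (m≤m+n a k)))
  ∷ All.map (λ {y} (a<y , y<) → <⇒≤ a<y , subst (y <_) (sym (+-suc a k)) y<) (iterate-suc-bounds (suc a) k)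

iterate-suc-increasing : ∀ a k → AllPairs _<_ (iterate suc a k)
iterate-suc-increasing a k = Linked⇒AllPairs <-trans (linked a k)
  where
    linked : ∀ a k → Linked _<_ (iterate suc a k)
    linked a zero          = []
    linked a (suc zero)    = [-]
    linked a (suc (suc k)) = n<1+n a ∷ linked (suc a) (suc k)

iterate-pred-bounds : ∀ a → All (λ y → 1 ≤ y × y ≤ a) (iterate pred a a)
iterate-pred-bounds zero    = []
iterate-pred-bounds (suc a) =
  (s≤s z≤n , ≤-refl) ∷ All.map (λ (1≤y , y≤a) → 1≤y , m≤n⇒m≤1+n y≤a) (iterate-pred-bounds a)

iterate-pred-decreasing : ∀ a → AllPairs _>_ (iterate pred a a)
iterate-pred-decreasing a = Linked⇒AllPairs (λ z<y y<x → <-trans y<x z<y) (linked a)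
  where
    linked : ∀ a → Linked _>_ (iterate pred a a)
    linked zero          = []
    linked (suc zero)    = [-]
    linked (suc (suc a)) = n<1+n (suc a) ∷ linked (suc a)

-- K, 0, …, K − 2, K + 1, …, K + r, K − 1 and 0, K, …, K + r, K − 1, …, 1: the one-line notation
-- and the cycle of the permutation of UnimodalCycle (K + r) K.
oneLineMiddle : ℕ → ℕ → List ℕ
oneLineMiddle K r = iterate suc 0 (pred K) ++ iterate suc (suc K) r

oneLineList : ℕ → ℕ → List ℕ
oneLineList K r = K ∷ oneLineMiddle K r ++ pred K ∷ []

cycleList : ℕ → ℕ → List ℕ
cycleList K r = (0 ∷ iterate suc K (suc r)) ++ iterate pred (pred K) (pred K)

module _ (K r : ℕ) where

  length-oneLineMiddle : length (oneLineMiddle K r) ≡ pred K + r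
  length-oneLineMiddle = trans (length-++ (iterate suc 0 (pred K)))
                               (cong₂ _+_ (length-iterate suc 0 (pred K)) (length-iterate suc (suc K) r))

  length-oneLineList : 1 ≤ K → length (oneLineList K r) ≡ suc (K + r)
  length-oneLineList (s≤s {n = K′} _) = cong suc (begin
    length (oneLineMiddle K r ++ K′ ∷ []) ≡⟨ length-++ (oneLineMiddle K r) ⟩
    length (oneLineMiddle K r) + 1        ≡⟨ cong (_+ 1) length-oneLineMiddle ⟩
    K′ + r + 1                            ≡⟨ +-comm (K′ + r) 1 ⟩
    K + r                                 ∎)
    where open ≡-Reasoning

  oneLineMiddle-increasing : AllPairs _<_ (oneLineMiddle K r)
  oneLineMiddle-increasing = AllPairsP.++⁺ (iterate-suc-increasing 0 (pred K)) (iterate-suc-increasing (suc K) r)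
    (All.map (λ (_ , y<K-1) → All.map (λ (K+1≤z , _) → <-trans y<K-1 (≤-<-trans pred[n]≤n K+1≤z))
                                      (iterate-suc-bounds (suc K) r))
             (iterate-suc-bounds 0 (pred K)))

  oneLineMiddle-avoids-K : All (λ y → y < pred K ⊎ K < y) (oneLineMiddle K r)
  oneLineMiddle-avoids-K = AllP.++⁺ (All.map (inj₁ ∘ proj₂) (iterate-suc-bounds 0 (pred K)))
                                    (All.map (inj₂ ∘ proj₁) (iterate-suc-bounds (suc K) r))

  oneLineList-unique : 1 ≤ K → Unique (oneLineList K r)
  oneLineList-unique 1≤K = AllP.++⁺ (All.map K≢ oneLineMiddle-avoids-K) (K≢K-1 ∷ [])
                         ∷ Unique.++⁺ (AllPairs.map <⇒≢ oneLineMiddle-increasing) ([] ∷ []) disjoint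
    where
      K-1<K = ≤-reflexive (suc-pred K {{>-nonZero 1≤K}})
      K≢K-1 : K ≢ pred K
      K≢K-1 K≡K-1 = <-irrefl (sym K≡K-1) K-1<K
      K≢ : ∀ {y} → y < pred K ⊎ K < y → K ≢ y
      K≢ (inj₁ y<K-1) refl = <-asym y<K-1 K-1<K
      K≢ (inj₂ K<y)   refl = <-irrefl refl K<y
      disjoint : ∀ {y} → y ∈ oneLineMiddle K r × y ∈ pred K ∷ [] → ⊥
      disjoint (y∈ , here refl) with All.lookup oneLineMiddle-avoids-K y∈
      ... | inj₁ y<y = <-irrefl refl y<y
      ... | inj₂ K<y = <-asym K<y K-1<K

oneLineList-unimodal : ∀ {K} r → 2 ≤ K → UnimodalCycle (K + r) K (at (oneLineList K r))
oneLineList-unimodal {K@(suc K′)} r 2≤K = record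
  { 2≤K = 2≤K ; K≤m = m≤m+n K r ; P-zero = refl
  ; P-below = P-below ; P-above = P-above ; P-last = P-last }
  where
    middle = oneLineMiddle K r
    P = at (oneLineList K r)
    <length-middle : ∀ {i} → i < K′ + r → i < length middle
    <length-middle {i} i< = subst (i <_) (sym (length-oneLineMiddle K r)) i<

    P-below : ∀ x → 1 ≤ x → x < K → P x ≡ pred x
    P-below (suc i) _ (s≤s i<K′) = begin
      at (middle ++ K′ ∷ []) i   ≡⟨ at-++ˡ middle (<length-middle (≤-trans i<K′ (m≤m+n K′ r))) ⟩
      at middle i                ≡⟨ at-++ˡ (iterate suc 0 K′) (subst (i <_) (sym (length-iterate suc 0 K′)) i<K′) ⟩
      at (iterate suc 0 K′) i    ≡⟨ at-iterate-suc 0 i<K′ ⟩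
      i                          ∎
      where open ≡-Reasoning

    P-above : ∀ x → K ≤ x → x < K + r → P x ≡ suc x
    P-above x K≤x x<K+r with m≤n⇒∃[o]m+o≡n K≤x
    ... | j , refl = begin
      at (middle ++ K′ ∷ []) (K′ + j)   ≡⟨ at-++ˡ middle (<length-middle (+-monoʳ-< K′ j<r)) ⟩
      at middle (K′ + j)                ≡⟨ at-++ʳ (iterate suc 0 K′) (cong (_+ j) (sym (length-iterate suc 0 K′))) ⟩
      at (iterate suc (suc K) r) j      ≡⟨ at-iterate-suc (suc K) j<r ⟩
      suc K + j                         ∎
      where
        open ≡-Reasoning
        j<r = +-cancelˡ-< K j r x<K+r

    P-last : P (K + r) ≡ K′
    P-last = at-++ʳ middle (trans (sym (+-identityʳ (K′ + r))) (cong (_+ 0) (sym (length-oneLineMiddle K r))))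

iterate-suc-prefix : ∀ f a k j → (∀ y → a ≤ y → y < a + k → f y ≡ suc y) →
                     iterate f a (suc k + j) ≡ iterate suc a (suc k) ++ iterate f (f (a + k)) j
iterate-suc-prefix f a zero    j _      = cong (λ x → a ∷ iterate f (f x) j) (sym (+-identityʳ a))
iterate-suc-prefix f a (suc k) j f≡suc = cong (a ∷_) (begin
  iterate f (f a) (suc k + j)
    ≡⟨ cong (λ x → iterate f x (suc k + j)) fa≡1+a ⟩
  iterate f (suc a) (suc k + j)
    ≡⟨ iterate-suc-prefix f (suc a) k j f≡suc′ ⟩
  iterate suc (suc a) (suc k) ++ iterate f (f (suc a + k)) j
    ≡⟨ cong (λ x → iterate suc (suc a) (suc k) ++ iterate f (f x) j) (+-suc a k) ⟨
  iterate suc (suc a) (suc k) ++ iterate f (f (a + suc k)) j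
    ∎)
  where
    open ≡-Reasoning
    fa≡1+a = f≡suc a ≤-refl (subst (a <_) (sym (+-suc a k)) (s≤s (m≤m+n a k)))
    f≡suc′ : ∀ y → suc a ≤ y → y < suc a + k → f y ≡ suc y
    f≡suc′ y a<y y< = f≡suc y (<⇒≤ a<y) (subst (y <_) (sym (+-suc a k)) y<)

iterate-pred-run : ∀ f a → (∀ y → 1 ≤ y → y ≤ a → f y ≡ pred y) → iterate f a a ≡ iterate pred a a
iterate-pred-run f zero    _       = refl
iterate-pred-run f (suc a) f≡pred = cong (suc a ∷_) (begin
  iterate f (f (suc a)) a   ≡⟨ cong (λ x → iterate f x a) (f≡pred (suc a) (s≤s z≤n) ≤-refl) ⟩
  iterate f a a             ≡⟨ iterate-pred-run f a (λ y 1≤y y≤a → f≡pred y 1≤y (m≤n⇒m≤1+n y≤a)) ⟩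
  iterate pred a a          ∎)
  where open ≡-Reasoning

UnimodalCycle-iterate : ∀ {K r P} → UnimodalCycle (K + r) K P → iterate P 0 (suc (K + r)) ≡ cycleList K r
UnimodalCycle-iterate {K@(suc K′)} {r} {P} U = cong (0 ∷_) (begin
  iterate P (P 0) (K + r)
    ≡⟨ cong₂ (iterate P) P-zero (cong suc (+-comm K′ r)) ⟩
  iterate P K (suc r + K′)
    ≡⟨ iterate-suc-prefix P K r K′ P-above ⟩
  iterate suc K (suc r) ++ iterate P (P (K + r)) K′
    ≡⟨ cong (λ x → iterate suc K (suc r) ++ iterate P x K′) P-last ⟩
  iterate suc K (suc r) ++ iterate P K′ K′
    ≡⟨ cong (iterate suc K (suc r) ++_) (iterate-pred-run P K′ λ y 1≤y y≤K′ → P-below y 1≤y (s≤s y≤K′)) ⟩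
  iterate suc K (suc r) ++ iterate pred K′ K′
    ∎)
  where
    open ≡-Reasoning
    open UnimodalCycle U

module _ (K r : ℕ) (1≤K : 1 ≤ K) where

  cycleList-increasing : AllPairs _<_ (0 ∷ iterate suc K (suc r))
  cycleList-increasing = All.map (λ (K≤y , _) → ≤-trans 1≤K K≤y) (iterate-suc-bounds K (suc r))
                       ∷ iterate-suc-increasing K (suc r)

  cycleList-unique : Unique (cycleList K r)
  cycleList-unique = Unique.++⁺ (AllPairs.map <⇒≢ cycleList-increasing)
                                (AllPairs.map (λ z<y → ≢-sym (<⇒≢ z<y)) (iterate-pred-decreasing (pred K)))
                                disjoint
    where
      disjoint : ∀ {y} → y ∈ 0 ∷ iterate suc K (suc r) × y ∈ iterate pred (pred K) (pred K) → ⊥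
      disjoint (y∈U , y∈D) with All.lookup (iterate-pred-bounds (pred K)) y∈D
      disjoint (here refl , _) | () , _
      disjoint (there y∈U , _) | _ , y≤K-1 =
        <⇒≱ (≤-<-trans y≤K-1 (≤-reflexive (suc-pred K {{>-nonZero 1≤K}})))
            (proj₁ (All.lookup (iterate-suc-bounds K (suc r)) y∈U))

  cycleList-avoids-213 : Avoids (cycleList K r) (2 ∷ 1 ∷ 3 ∷ [])
  cycleList-avoids-213 = increasing++decreasing-avoids-213 cycleList-increasing (iterate-pred-decreasing (pred K))

last-++-∷ : ∀ (xs : List ℕ) y ys → last (xs ++ y ∷ ys) ≡ last (y ∷ ys)
last-++-∷ []           y ys = refl
last-++-∷ (x ∷ [])     y ys = refl
last-++-∷ (x ∷ x′ ∷ xs) y ys = last-++-∷ (x′ ∷ xs) y ys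

last-iterate-pred : ∀ a → last (iterate pred (suc a) (suc a)) ≡ just 1
last-iterate-pred zero    = refl
last-iterate-pred (suc a) = last-iterate-pred a

cycleList-last : ∀ {K} r → 2 ≤ K → last (cycleList K r) ≡ just 1
cycleList-last {suc (suc k)} r (s≤s (s≤s z≤n)) =
  trans (last-++-∷ (0 ∷ iterate suc (2 + k) (suc r)) (suc k) _) (last-iterate-pred k)

-- The entries are at most m, so `mod` only supplies the bound required by Fin.
canonical : (m K : ℕ) → Vec (Fin (suc m)) (suc m)
canonical m K = Vec.tabulate λ i → at (oneLineList K (m ∸ K)) (toℕ i) mod suc m

module _ {m K : ℕ} (2≤K : 2 ≤ K) (K≤m : K ≤ m) where

  private
    r = m ∸ K
    v = canonical m K
    K+r≡m : K + r ≡ m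
    K+r≡m = m+[n∸m]≡n K≤m
    1≤K = <⇒≤ 2≤K
    L = oneLineList K r
    L-unimodal : UnimodalCycle m K (at L)
    L-unimodal = subst (λ M → UnimodalCycle M K (at L)) K+r≡m (oneLineList-unimodal r 2≤K)

  oneLine-canonical : oneLine v ≡ oneLineList K r
  oneLine-canonical = at-extensional
    (trans (length-oneLine v) (sym (trans (length-oneLineList K r 1≤K) (cong suc K+r≡m))))
    λ i i< → entry (subst (i <_) (length-oneLine v) i<)
    where
      entry : ∀ {i} (i<1+m : i < suc m) → at (oneLine v) i ≡ at L i
      entry {i} i<1+m = begin
        at (oneLine v) i
          ≡⟨ at-oneLine v i<1+m ⟩
        toℕ (lookup v (fromℕ< i<1+m))
          ≡⟨ cong toℕ (Vec.lookup∘tabulate (λ j → at L (toℕ j) mod suc m) (fromℕ< i<1+m)) ⟩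
        toℕ (at L (toℕ (fromℕ< i<1+m)) mod suc m)
          ≡⟨ Fin.toℕ-fromℕ< _ ⟩
        at L (toℕ (fromℕ< i<1+m)) % suc m
          ≡⟨ cong (λ j → at L j % suc m) (Fin.toℕ-fromℕ< i<1+m) ⟩
        at L i % suc m
          ≡⟨ m<n⇒m%n≡m (s≤s (UnimodalCycle-≤ L-unimodal (s≤s⁻¹ i<1+m))) ⟩
        at L i
          ∎
        where open ≡-Reasoning

  canonical-unimodal : UnimodalCycle m K (at (oneLine v))
  canonical-unimodal = subst (λ l → UnimodalCycle m K (at l)) (sym oneLine-canonical) L-unimodal

  cycleSeq-canonical : cycleSeq v ≡ cycleList K r
  cycleSeq-canonical = trans (cycleSeq-iterate v)
    (subst (λ M → UnimodalCycle M K (at (oneLine v)) → iterate (at (oneLine v)) 0 (suc M) ≡ cycleList K r)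
           K+r≡m UnimodalCycle-iterate canonical-unimodal)

  canonical-InA2n : InA2n v
  canonical-InA2n = ((isPerm , cycle-unique) , avoids-1324 , avoids-1423 , avoids-213) , last≡2
    where
      isPerm : IsPerm v
      isPerm i j lookups≡ = Fin.toℕ-injective (at-injective oneLine-unique (<length i) (<length j) (begin
        at (oneLine v) (toℕ i)  ≡⟨ at-toℕ-toList v i ⟩
        toℕ (lookup v i)        ≡⟨ cong toℕ lookups≡ ⟩
        toℕ (lookup v j)        ≡⟨ at-toℕ-toList v j ⟨
        at (oneLine v) (toℕ j)  ∎))
        where
          open ≡-Reasoning
          oneLine-unique = subst Unique (sym oneLine-canonical) (oneLineList-unique K r 1≤K)
          <length : ∀ (i : Fin (suc m)) → toℕ i < length (oneLine v)
          <length i = subst (toℕ i <_) (sym (length-oneLine v)) (Fin.toℕ<n i)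
      cycle-unique : Unique (cycleForm v)
      cycle-unique = Unique.map⁻ (subst Unique (sym cycleSeq-canonical) (cycleList-unique K r 1≤K))
      avoids-1324 : Avoids (oneLine v) (1 ∷ 3 ∷ 2 ∷ 4 ∷ [])
      avoids-1324 = subst (λ w → Avoids w (1 ∷ 3 ∷ 2 ∷ 4 ∷ [])) (sym oneLine-canonical)
                          (increasing-inside-avoids (oneLineMiddle-increasing K r) (s≤s (s≤s (s≤s z≤n))))
      avoids-1423 : Avoids (oneLine v) (1 ∷ 4 ∷ 2 ∷ 3 ∷ [])
      avoids-1423 = subst (λ w → Avoids w (1 ∷ 4 ∷ 2 ∷ 3 ∷ [])) (sym oneLine-canonical)
                          (increasing-inside-avoids (oneLineMiddle-increasing K r) (s≤s (s≤s (s≤s z≤n))))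
      avoids-213 : Avoids (cycleSeq v) (2 ∷ 1 ∷ 3 ∷ [])
      avoids-213 = subst (λ w → Avoids w (2 ∷ 1 ∷ 3 ∷ [])) (sym cycleSeq-canonical) (cycleList-avoids-213 K r 1≤K)
      last≡2 : last (cycleSeq v) ≡ just 1
      last≡2 = trans (cong last cycleSeq-canonical) (cycleList-last r 2≤K)

-- Counting

oneLine-at-injective : ∀ {m} {v w : Vec (Fin (suc m)) (suc m)} →
                       (∀ {x} → x ≤ m → at (oneLine v) x ≡ at (oneLine w) x) → v ≡ w
oneLine-at-injective {v = v} {w} agree = begin
  v                     ≡⟨ Vec.tabulate∘lookup v ⟨
  Vec.tabulate (lookup v) ≡⟨ Vec.tabulate-cong lookups≡ ⟩
  Vec.tabulate (lookup w) ≡⟨ Vec.tabulate∘lookup w ⟩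
  w                     ∎
  where
    open ≡-Reasoning
    lookups≡ : ∀ i → lookup v i ≡ lookup w i
    lookups≡ i = Fin.toℕ-injective (trans (sym (at-toℕ-toList v i))
                   (trans (agree (s≤s⁻¹ (Fin.toℕ<n i))) (at-toℕ-toList w i)))

canonicals : (m : ℕ) → List (Vec (Fin (suc m)) (suc m))
canonicals m = applyUpTo (λ i → canonical m (2 + i)) (m ∸ 1)

2+≤⇒<∸1 : ∀ {i m} → 2 + i ≤ m → i < m ∸ 1
2+≤⇒<∸1 {m = suc m} (s≤s 1+i≤m) = 1+i≤m

<∸1⇒2+≤ : ∀ {i m} → i < m ∸ 1 → 2 + i ≤ m
<∸1⇒2+≤ {m = suc m} i<m = s≤s i<m

canonical-injective : ∀ {m i j} → i < m ∸ 1 → j < m ∸ 1 → canonical m (2 + i) ≡ canonical m (2 + j) → i ≡ j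
canonical-injective {m} {i} {j} i< j< v≡w = suc-injective (suc-injective (begin
  2 + i                                  ≡⟨ UnimodalCycle.P-zero (canonical-unimodal (m≤m+n 2 i) (<∸1⇒2+≤ i<)) ⟨
  at (oneLine (canonical m (2 + i))) 0   ≡⟨ cong (λ v → at (oneLine v) 0) v≡w ⟩
  at (oneLine (canonical m (2 + j))) 0   ≡⟨ UnimodalCycle.P-zero (canonical-unimodal (m≤m+n 2 j) (<∸1⇒2+≤ j<)) ⟩
  2 + j                                  ∎))
  where open ≡-Reasoning

canonicals-unique : ∀ m → Unique (canonicals m)
canonicals-unique m = Unique.applyUpTo⁺₁ _ (m ∸ 1) λ i<j j< → <⇒≢ i<j ∘ canonical-injective (<-trans i<j j<) j<

InA2n⇒canonical : ∀ {m} → 2 ≤ m → ∀ v → InA2n v → ∃[ K ] 2 ≤ K × K ≤ m × v ≡ canonical m K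
InA2n⇒canonical 2≤m v v∈A = K , 2≤K , K≤m ,
  oneLine-at-injective (UnimodalCycle-unique unimodal (canonical-unimodal 2≤K K≤m))
  where open Forward 2≤m (InA2n⇒InA2nFun v v∈A)

∈-canonicals : ∀ {m} → 2 ≤ m → ∀ v → v ∈ canonicals m ⇔ InA2n v
∈-canonicals {m} 2≤m v = mk⇔ to from
  where
    to : v ∈ canonicals m → InA2n v
    to v∈ with ∈-applyUpTo⁻ _ v∈
    ... | i , i< , refl = canonical-InA2n (m≤m+n 2 i) (<∸1⇒2+≤ i<)
    from : InA2n v → v ∈ canonicals m
    from v∈A with InA2n⇒canonical 2≤m v v∈A
    ... | K , 2≤K , K≤m , refl with m≤n⇒∃[o]m+o≡n 2≤K
    ...   | i , refl = ∈-applyUpTo⁺ _ (2+≤⇒<∸1 K≤m)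

lemma4p7 : (n : ℕ) → 3 ≤ n → HasCard (InA2n {n}) (n ∸ 2)
lemma4p7 (suc m) (s≤s 2≤m) = canonicals m , canonicals-unique m , ∈-canonicals 2≤m , length-applyUpTo _ (m ∸ 1)
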